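{- Let $A,B$ be indeterminates and define a sequence $(s_n)_{n\ge0}$ in $\mathbb F_p[A,B]$ by $s_0=1$, $s_n=0$ for $1\le n\le p$, and $s_n=As_{n-p}+Bs_{n-p-1}$ for $n\ge p+1$. Then for every $n\in\mathbb N$ with $\delta_p(n(p-1))=p-1$ we have $s_n=0$.
   Context: $p$ is a prime (the paper takes $p\ge5$). For $m\in\mathbb Z_{\ge0}$ with base-$p$ expansion $m=\sum_i a_ip^i$, $a_i\in\{0,\dots,p-1\}$, $\delta_p(m)=\sum_ia_i$. -}

module Defs where

open import Data.Nat using (ℕ; zero; suc; _+_; _*_; _∸_; _≤ᵇ_; NonZero)
open import Data.Nat.DivMod using (_%_; _/_)
open import Data.Bool using (if_then_else_)

-- Base-p digit sum δ_p(m).  Fuel-based recursion: fuel m suffices since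
-- m / p < m for m > 0 and p ≥ 2.
digitSumAux : (p : ℕ) .{{_ : NonZero p}} → ℕ → ℕ → ℕ
digitSumAux p zero    m       = 0
digitSumAux p (suc f) zero    = 0
digitSumAux p (suc f) (suc m) = (suc m % p) + digitSumAux p f (suc m / p)

δ : (p : ℕ) .{{_ : NonZero p}} → ℕ → ℕ
δ p m = digitSumAux p m m

-- Elements of F_p[A,B], represented by their coefficient function:
-- f a b is the coefficient of A^a B^b, an element of F_p = ℤ/pℤ given by
-- its residue in {0,…,p-1}.
Poly : Set
Poly = ℕ → ℕ → ℕ

one : (p : ℕ) .{{_ : NonZero p}} → Poly
one p zero    zero    = 1 % p
one p zero    (suc b) = 0
one p (suc a) b       = 0

zeroP : Poly
zeroP a b = 0

_⊕[_]_ : Poly → (p : ℕ) → .{{_ : NonZero p}} → Poly → Poly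
(f ⊕[ p ] g) a b = (f a b + g a b) % p

mulA : Poly → Poly
mulA f zero    b = 0
mulA f (suc a) b = f a b

mulB : Poly → Poly
mulB f a zero    = 0
mulB f a (suc b) = f a b

-- s_0 = 1, s_n = 0 for 1 ≤ n ≤ p, s_n = A s_{n-p} + B s_{n-p-1} for n ≥ p+1.
-- Fuel-based recursion (fuel suc n suffices since each call lowers n by ≥ 1).
sAux : (p : ℕ) .{{_ : NonZero p}} → ℕ → ℕ → Poly
sAux p zero    n       = zeroP
sAux p (suc f) zero    = one p
sAux p (suc f) (suc n) =
  if suc n ≤ᵇ p then zeroP
  else (mulA (sAux p f (suc n ∸ p)) ⊕[ p ] mulB (sAux p f (suc n ∸ p ∸ 1)))

s : (p : ℕ) .{{_ : NonZero p}} → ℕ → Poly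
s p n = sAux p (suc n) n

-- Unwinding the recursion, the coefficient of AᵃBᵇ in sₙ vanishes unless
-- n = pa + (p+1)b, and for b ≥ 1 it is then C(a+b-1, a) mod p: the words in
-- A (step p) and B (step p+1) leading from s₀ to sₙ must start with B, since
-- s₁ = … = s_p = 0.  By Lucas' theorem this is nonzero only if a + (b-1) has no
-- carry in base p.  On the other hand δ(n(p-1)) = p-1 says that y = n(p-1)
-- solves y = (p-1)(n-1) + δ(y), and peeling base-p digits off this equation
-- shows that the digits of n-1 weakly decrease upwards.  For a carry-free pair,
-- however, n-1 = pa + (p+1)(b-1) + p has a digit exceeding the one below it.

module Submission where

open import Defs
open import Data.Bool.Base using (if_then_else_; true; false)
open import Data.Nat
open import Data.Nat.Combinatorics using (_C_; nCn≡1; nCk≡n!/k![n-k]!; k![n∸k]!∣n!; nCk+nC[k+1]≡[n+1]C[k+1])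
open import Data.Nat.Divisibility using (_∣_; ∣⇒≤; ∣1⇒≡1; m∣m*n; n∣m*n; n∣m⇒m%n≡0)
open import Data.Nat.DivMod
open import Data.Nat.Induction using (<-wellFounded)
open import Data.Nat.Primality using (Prime; euclidsLemma; prime⇒nonTrivial)
open import Data.Nat.Properties
open import Data.Nat.Tactic.RingSolver using (solve-∀)
open import Data.Product using (Σ-syntax; _×_; _,_; proj₁; proj₂)
open import Data.Sum using (inj₁; inj₂)
open import Induction.WellFounded using (Acc; acc)
open import Relation.Nullary using (¬_; yes; no; contradiction)
open import Relation.Nullary.Decidable using (decidable-stable)
open import Relation.Binary.PropositionalEquality
open import Relation.Binary.Definitions using (tri<; tri≈; tri>)

[r+kn]%n≡r : ∀ {r} k {n} .{{_ : NonZero n}} → r < n → (r + k * n) % n ≡ r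
[r+kn]%n≡r {r} k {n} r<n = trans ([m+kn]%n≡m%n r k n) (m<n⇒m%n≡m r<n)

[r+kn]/n≡k : ∀ {r} k {n} .{{_ : NonZero n}} → r < n → (r + k * n) / n ≡ k
[r+kn]/n≡k {r} k {n} r<n = begin
  (r + k * n) / n    ≡⟨ +-distrib-/-∣ʳ r (n∣m*n k) ⟩
  r / n + k * n / n  ≡⟨ cong₂ _+_ (m<n⇒m/n≡0 r<n) (m*n/n≡m k n) ⟩
  k                  ∎
  where open ≡-Reasoning

[1+m]/n≤m : ∀ m {n} .{{_ : NonZero n}} → 1 < n → suc m / n ≤ m
[1+m]/n≤m m {n} 1<n = ≤-pred (m/n<m (suc m) n 1<n)

prime∤! : ∀ {p} → Prime p → ∀ {m} → m < p → ¬ p ∣ m !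
prime∤! {p} p-prime {zero}  _   p∣1  = <⇒≢ (nonTrivial⇒n>1 p {{prime⇒nonTrivial p-prime}}) (sym (∣1⇒≡1 p∣1))
prime∤! p-prime {suc m} m<p p∣m! with euclidsLemma (suc m) (m !) p-prime p∣m!
... | inj₁ p∣1+m = <⇒≱ m<p (∣⇒≤ p∣1+m)
... | inj₂ p∣m!  = prime∤! p-prime (<-trans (n<1+n m) m<p) p∣m!

nCk*k![n∸k]!≡n! : ∀ {n k} → k ≤ n → (n C k) * (k ! * (n ∸ k) !) ≡ n !
nCk*k![n∸k]!≡n! {n} {k} k≤n = begin
  (n C k) * (k ! * (n ∸ k) !)                  ≡⟨ cong (_* (k ! * (n ∸ k) !)) (nCk≡n!/k![n-k]! k≤n) ⟩
  (n ! / (k ! * (n ∸ k) !)) * (k ! * (n ∸ k) !) ≡⟨ m/n*n≡m (k![n∸k]!∣n! k≤n) ⟩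
  n !                                          ∎
  where
  instance _ = k !* (n ∸ k) !≢0
  open ≡-Reasoning

prime∣pCk : ∀ {p} → Prime p → ∀ {k} → 0 < k → k < p → p ∣ p C k
prime∣pCk {suc q} p-prime {k} 0<k k<p
  with euclidsLemma (suc q C k) (k ! * (suc q ∸ k) !) p-prime
                    (subst (suc q ∣_) (sym (nCk*k![n∸k]!≡n! (<⇒≤ k<p))) (m∣m*n (q !)))
... | inj₁ p∣pCk = p∣pCk
... | inj₂ p∣k![p∸k]! with euclidsLemma (k !) ((suc q ∸ k) !) p-prime p∣k![p∸k]!
...   | inj₁ p∣k!     = contradiction p∣k! (prime∤! p-prime k<p)
...   | inj₂ p∣[p∸k]! = contradiction p∣[p∸k]! (prime∤! p-prime (∸-monoʳ-< 0<k (<⇒≤ k<p)))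

module DigitSum (q : ℕ) .{{_ : NonZero q}} where

  private
    p : ℕ
    p = suc q

  1<p : 1 < p
  1<p = s≤s (>-nonZero⁻¹ q)

  digitSumAux-fuel : ∀ {f g} m → m ≤ f → m ≤ g → digitSumAux p f m ≡ digitSumAux p g m
  digitSumAux-fuel {zero}  {zero}  zero    _         _         = refl
  digitSumAux-fuel {zero}  {suc g} zero    _         _         = refl
  digitSumAux-fuel {suc f} {zero}  zero    _         _         = refl
  digitSumAux-fuel {suc f} {suc g} zero    _         _         = refl
  digitSumAux-fuel {suc f} {suc g} (suc m) (s≤s m≤f) (s≤s m≤g) =
    cong (suc m % p +_) (digitSumAux-fuel (suc m / p) (≤-trans ([1+m]/n≤m m 1<p) m≤f) (≤-trans ([1+m]/n≤m m 1<p) m≤g))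

  δ-unfold : ∀ m → δ p m ≡ m % p + δ p (m / p)
  δ-unfold zero    = refl
  δ-unfold (suc m) = cong (suc m % p +_) (digitSumAux-fuel (suc m / p) ([1+m]/n≤m m 1<p) ≤-refl)

  δ-/-≤ : ∀ m → δ p (m / p) ≤ δ p m
  δ-/-≤ m = subst (δ p (m / p) ≤_) (sym (δ-unfold m)) (m≤n+m _ _)

  δ-equation-step : ∀ {X y} → q * X + δ p y ≡ y → δ p y < p →
                    X % p ≡ δ p (y / p) × q * (X / p) + δ p (y / p) ≡ y / p
  δ-equation-step {X} {y} eq δy<p = sym d≡X%p , *-cancelʳ-≡ _ _ p qk+d≡y'
    where
    open ≡-Reasoning
    y' d k : ℕ
    y' = y / p
    d  = δ p y'
    k  = X / p

    d<p : d < p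
    d<p = ≤-<-trans (δ-/-≤ y) δy<p

    qX+d≡y'p : q * X + d ≡ y' * p
    qX+d≡y'p = +-cancelˡ-≡ (y % p) _ _ (begin
      y % p + (q * X + d)  ≡⟨ x+[y+z]≡y+[x+z] (y % p) (q * X) d ⟩
      q * X + (y % p + d)  ≡⟨ cong (q * X +_) (δ-unfold y) ⟨
      q * X + δ p y        ≡⟨ eq ⟩
      y                    ≡⟨ m≡m%n+[m/n]*n y p ⟩
      y % p + y' * p       ∎)
      where
      x+[y+z]≡y+[x+z] : ∀ x y z → x + (y + z) ≡ y + (x + z)
      x+[y+z]≡y+[x+z] = solve-∀

    d≡X%p : d ≡ X % p
    d≡X%p = begin
      d                   ≡⟨ [r+kn]%n≡r X d<p ⟨
      (d + X * p) % p     ≡⟨ cong (_% p) (d+Xp≡X+[qX+d] q d X) ⟩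
      (X + (q * X + d)) % p ≡⟨ cong (λ z → (X + z) % p) qX+d≡y'p ⟩
      (X + y' * p) % p    ≡⟨ [m+kn]%n≡m%n X y' p ⟩
      X % p               ∎
      where
      d+Xp≡X+[qX+d] : ∀ q d X → d + X * suc q ≡ X + (q * X + d)
      d+Xp≡X+[qX+d] = solve-∀

    qk+d≡y' : (q * k + d) * p ≡ y' * p
    qk+d≡y' = begin
      (q * k + d) * p        ≡⟨ [qk+d]p≡q[d+kp]+d q d k ⟩
      q * (d + k * p) + d    ≡⟨ cong (λ z → q * (z + k * p) + d) d≡X%p ⟩
      q * (X % p + k * p) + d ≡⟨ cong (λ z → q * z + d) (m≡m%n+[m/n]*n X p) ⟨
      q * X + d              ≡⟨ qX+d≡y'p ⟩
      y' * p                 ∎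
      where
      [qk+d]p≡q[d+kp]+d : ∀ q d k → (q * k + d) * suc q ≡ q * (d + k * suc q) + d
      [qk+d]p≡q[d+kp]+d = solve-∀

  -- Satisfied by X = n - 1 when δ(n (p-1)) = p - 1 (take y = n (p-1)); its
  -- content is that the base-p digits of X weakly decrease upwards.
  DigitSumWitness : ℕ → Set
  DigitSumWitness X = Σ[ y ∈ ℕ ] q * X + δ p y ≡ y × δ p y < p

  witness-pred : ∀ X → δ p (suc X * q) ≡ q → DigitSumWitness X
  witness-pred X δ≡q = suc X * q , equation , subst (_< p) (sym δ≡q) ≤-refl
    where
    equation : q * X + δ p (suc X * q) ≡ suc X * q
    equation = trans (cong (q * X +_) δ≡q) (trans (+-comm (q * X) q) (cong (q +_) (*-comm q X)))

  witness-/ : ∀ {X} → DigitSumWitness X → DigitSumWitness (X / p)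
  witness-/ (y , eq , δy<p) = y / p , proj₂ (δ-equation-step eq δy<p) , ≤-<-trans (δ-/-≤ y) δy<p

  witness-low-digit : ∀ {X} (w : DigitSumWitness X) → X % p ≡ δ p (proj₁ w / p)
  witness-low-digit (_ , eq , δy<p) = proj₁ (δ-equation-step eq δy<p)

  witness-digit-≤ : ∀ {X} → DigitSumWitness X → (X / p) % p ≤ X % p
  witness-digit-≤ w@(y , _) =
    subst₂ _≤_ (sym (witness-low-digit (witness-/ w))) (sym (witness-low-digit w)) (δ-/-≤ (y / p))

module Lucas {q : ℕ} (p-prime : Prime (suc q)) where

  private
    p : ℕ
    p = suc q

    1<p : 1 < p
    1<p = nonTrivial⇒n>1 p {{prime⇒nonTrivial p-prime}}

    0<q : 0 < q
    0<q = ≤-pred 1<p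

    %-cong-*ʳ : ∀ x y z → x % p ≡ y % p → (x * z) % p ≡ (y * z) % p
    %-cong-*ʳ x y z x≡y = begin
      (x * z) % p              ≡⟨ %-distribˡ-* x z p ⟩
      ((x % p) * (z % p)) % p  ≡⟨ cong (λ w → (w * (z % p)) % p) x≡y ⟩
      ((y % p) * (z % p)) % p  ≡⟨ %-distribˡ-* y z p ⟨
      (y * z) % p              ∎
      where open ≡-Reasoning

  C<p : ℕ → ℕ → ℕ
  C<p n k = if n <ᵇ p then n C k else 0

  C<p-< : ∀ {n} k → n < p → C<p n k ≡ n C k
  C<p-< {n} k n<p with n <ᵇ p | <⇒<ᵇ n<p
  ... | true | _ = refl

  C<p-≥ : ∀ {n} k → p ≤ n → C<p n k ≡ 0
  C<p-≥ {n} k p≤n with n <ᵇ p | <ᵇ⇒< n p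
  ... | true  | n<p = contradiction (n<p _) (≤⇒≯ p≤n)
  ... | false | _   = refl

  C<p-pascal : ∀ n k → suc k < p → C<p (suc n) (suc k) % p ≡ (C<p n k + C<p n (suc k)) % p
  C<p-pascal n k 1+k<p with <-cmp (suc n) p
  ... | tri< 1+n<p _ _
    rewrite C<p-< (suc k) 1+n<p | C<p-< k (<⇒≤ 1+n<p) | C<p-< (suc k) (<⇒≤ 1+n<p)
    = cong (_% p) (sym (nCk+nC[k+1]≡[n+1]C[k+1] n k))
  ... | tri> _ _ p<1+n
    rewrite C<p-≥ (suc k) (<⇒≤ p<1+n) | C<p-≥ k (≤-pred p<1+n) | C<p-≥ (suc k) (≤-pred p<1+n)
    = refl
  ... | tri≈ _ 1+n≡p _
    rewrite C<p-≥ (suc k) (≤-reflexive (sym 1+n≡p)) | C<p-< k (≤-reflexive 1+n≡p) | C<p-< (suc k) (≤-reflexive 1+n≡p)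
    = sym (begin
      (n C k + n C suc k) % p  ≡⟨ cong (_% p) (nCk+nC[k+1]≡[n+1]C[k+1] n k) ⟩
      (suc n C suc k) % p      ≡⟨ n∣m⇒m%n≡0 _ p (subst (λ m → p ∣ m C suc k) (sym 1+n≡p) (prime∣pCk p-prime z<s 1+k<p)) ⟩
      0                        ∎)
    where open ≡-Reasoning

  digitC : ℕ → ℕ → ℕ
  digitC x y = C<p (x + y) x

  digitC-0ˡ : ∀ {y} → y < p → digitC 0 y ≡ 1
  digitC-0ˡ y<p = C<p-< 0 y<p

  digitC-0ʳ : ∀ {x} → x < p → digitC x 0 ≡ 1
  digitC-0ʳ {x} x<p = begin
    C<p (x + 0) x  ≡⟨ C<p-< x (subst (_< p) (sym (+-identityʳ x)) x<p) ⟩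
    (x + 0) C x    ≡⟨ cong (_C x) (+-identityʳ x) ⟩
    x C x          ≡⟨ nCn≡1 x ⟩
    1              ∎
    where open ≡-Reasoning

  digitC-pascal : ∀ x y → suc x < p → digitC (suc x) (suc y) % p ≡ (digitC x (suc y) + digitC (suc x) y) % p
  digitC-pascal x y 1+x<p =
    subst (λ n → C<p (suc n) (suc x) % p ≡ (C<p n x + C<p (suc (x + y)) (suc x)) % p)
          (sym (+-suc x y)) (C<p-pascal (suc (x + y)) x 1+x<p)

  lucasAux : ℕ → ℕ → ℕ → ℕ
  lucasAux zero    a b = 1
  lucasAux (suc f) a b = digitC (a % p) (b % p) * lucasAux f (a / p) (b / p)

  -- ∏ᵢ C(aᵢ + bᵢ, aᵢ) over the base-p digits of a and b, zero if some aᵢ + bᵢ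
  -- carries; fuel a suffices since digitC 0 y = 1.
  lucas : ℕ → ℕ → ℕ
  lucas a b = lucasAux a a b

  lucasAux-0ˡ : ∀ f b → lucasAux f 0 b ≡ 1
  lucasAux-0ˡ zero    b = refl
  lucasAux-0ˡ (suc f) b = cong₂ _*_ (digitC-0ˡ (m%n<n b p)) (lucasAux-0ˡ f (b / p))

  lucasAux-0ʳ : ∀ f a → lucasAux f a 0 ≡ 1
  lucasAux-0ʳ zero    a = refl
  lucasAux-0ʳ (suc f) a = cong₂ _*_ (digitC-0ʳ (m%n<n a p)) (lucasAux-0ʳ f (a / p))

  lucasAux-fuel : ∀ {f g} a b → a ≤ f → a ≤ g → lucasAux f a b ≡ lucasAux g a b
  lucasAux-fuel {f} {g} zero b _ _ = trans (lucasAux-0ˡ f b) (sym (lucasAux-0ˡ g b))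
  lucasAux-fuel {suc f} {suc g} (suc a) b (s≤s a≤f) (s≤s a≤g) =
    cong (digitC (suc a % p) (b % p) *_)
         (lucasAux-fuel (suc a / p) (b / p) (≤-trans ([1+m]/n≤m a 1<p) a≤f) (≤-trans ([1+m]/n≤m a 1<p) a≤g))

  lucas-unfold : ∀ a b → lucas a b ≡ digitC (a % p) (b % p) * lucas (a / p) (b / p)
  lucas-unfold zero    b = sym (trans (*-identityʳ _) (digitC-0ˡ (m%n<n b p)))
  lucas-unfold (suc a) b = cong (digitC (suc a % p) (b % p) *_)
    (lucasAux-fuel (suc a / p) (b / p) ([1+m]/n≤m a 1<p) ≤-refl)

  lucas-digits : ∀ {i j} A B → i < p → j < p → lucas (i + A * p) (j + B * p) ≡ digitC i j * lucas A B
  lucas-digits {i} {j} A B i<p j<p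
    rewrite lucas-unfold (i + A * p) (j + B * p)
          | [r+kn]%n≡r A i<p | [r+kn]/n≡k A i<p | [r+kn]%n≡r B j<p | [r+kn]/n≡k B j<p
          = refl

  lucas-digits-carry : ∀ {i j} A B → i < p → j < p → p ≤ i + j → lucas (i + A * p) (j + B * p) ≡ 0
  lucas-digits-carry {i} A B i<p j<p carry = trans (lucas-digits A B i<p j<p) (cong (_* lucas A B) (C<p-≥ i carry))

  lucas-digits-unit : ∀ {i j} A B → i < p → j < p → digitC i j ≡ 1 → lucas (i + A * p) (j + B * p) ≡ lucas A B
  lucas-digits-unit A B i<p j<p unit =
    trans (lucas-digits A B i<p j<p) (trans (cong (_* lucas A B) unit) (*-identityˡ (lucas A B)))

  data LowDigit : ℕ → Set where
    below : ∀ {i} k → suc i < p → LowDigit (i + k * p)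
    top   : ∀ k → LowDigit (q + k * p)

  lowDigit : ∀ a → LowDigit a
  lowDigit a with suc (a % p) <? p
  ... | yes 1+r<p = subst LowDigit (sym (m≡m%n+[m/n]*n a p)) (below (a / p) 1+r<p)
  ... | no  1+r≮p = subst LowDigit (sym (trans (m≡m%n+[m/n]*n a p) (cong (_+ a / p * p) r≡q))) (top (a / p))
    where
    r≡q : a % p ≡ q
    r≡q = ≤-antisym (≤-pred (m%n<n a p)) (≤-pred (≮⇒≥ 1+r≮p))

  LucasPascal : ℕ → ℕ → Set
  LucasPascal a b = lucas (suc a) (suc b) % p ≡ (lucas a (suc b) + lucas (suc a) b) % p

  lucas-pascal-below : ∀ {i j} A B → suc i < p → suc j < p → LucasPascal (i + A * p) (j + B * p)
  lucas-pascal-below {i} {j} A B 1+i<p 1+j<p = begin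
    lucas (suc i + A * p) (suc j + B * p) % p
      ≡⟨ cong (_% p) (lucas-digits A B 1+i<p 1+j<p) ⟩
    (digitC (suc i) (suc j) * lucas A B) % p
      ≡⟨ %-cong-*ʳ (digitC (suc i) (suc j)) (digitC i (suc j) + digitC (suc i) j) (lucas A B) (digitC-pascal i j 1+i<p) ⟩
    ((digitC i (suc j) + digitC (suc i) j) * lucas A B) % p
      ≡⟨ cong (_% p) (*-distribʳ-+ (lucas A B) (digitC i (suc j)) _) ⟩
    (digitC i (suc j) * lucas A B + digitC (suc i) j * lucas A B) % p
      ≡⟨ cong₂ (λ u v → (u + v) % p) (lucas-digits A B (<⇒≤ 1+i<p) 1+j<p) (lucas-digits A B 1+i<p (<⇒≤ 1+j<p)) ⟨
    (lucas (i + A * p) (suc j + B * p) + lucas (suc i + A * p) (j + B * p)) % p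
      ∎
    where open ≡-Reasoning

  lucas-pascal-topˡ : ∀ {j} A B → suc j < p → LucasPascal (q + A * p) (j + B * p)
  lucas-pascal-topˡ {j} A B 1+j<p = cong (_% p) (begin
    lucas (suc A * p) (suc j + B * p)  ≡⟨ lucas-digits-unit (suc A) B z<s 1+j<p (digitC-0ˡ 1+j<p) ⟩
    lucas (suc A) B                    ≡⟨ lucas-digits-unit (suc A) B z<s (<⇒≤ 1+j<p) (digitC-0ˡ (<⇒≤ 1+j<p)) ⟨
    lucas (suc A * p) (j + B * p)      ≡⟨ cong (_+ lucas (suc A * p) (j + B * p)) (lucas-digits-carry A B ≤-refl 1+j<p carry) ⟨
    lucas (q + A * p) (suc j + B * p) + lucas (suc A * p) (j + B * p) ∎)
    where
    open ≡-Reasoning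
    carry : p ≤ q + suc j
    carry = subst (p ≤_) (sym (+-suc q j)) (s≤s (m≤m+n q j))

  lucas-pascal-topʳ : ∀ {i} A B → suc i < p → LucasPascal (i + A * p) (q + B * p)
  lucas-pascal-topʳ {i} A B 1+i<p = cong (_% p) (begin
    lucas (suc i + A * p) (suc B * p)  ≡⟨ lucas-digits-unit A (suc B) 1+i<p z<s (digitC-0ʳ 1+i<p) ⟩
    lucas A (suc B)                    ≡⟨ lucas-digits-unit A (suc B) (<⇒≤ 1+i<p) z<s (digitC-0ʳ (<⇒≤ 1+i<p)) ⟨
    lucas (i + A * p) (suc B * p)      ≡⟨ +-identityʳ _ ⟨
    lucas (i + A * p) (suc B * p) + 0  ≡⟨ cong (lucas (i + A * p) (suc B * p) +_) (lucas-digits-carry A B 1+i<p ≤-refl (s≤s (m≤n+m q i))) ⟨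
    lucas (i + A * p) (suc B * p) + lucas (suc i + A * p) (q + B * p) ∎)
    where open ≡-Reasoning

  lucas-pascal : ∀ {a} → Acc _<_ a → ∀ b → LucasPascal a b
  lucas-pascal {a} rec b with lowDigit a | lowDigit b
  ... | below A 1+i<p | below B 1+j<p = lucas-pascal-below A B 1+i<p 1+j<p
  ... | top A         | below B 1+j<p = lucas-pascal-topˡ A B 1+j<p
  ... | below A 1+i<p | top B         = lucas-pascal-topʳ A B 1+i<p
  ... | top A         | top B with acc rs ← rec = begin
    lucas (suc A * p) (suc B * p) % p
      ≡⟨ cong (_% p) (lucas-digits-unit (suc A) (suc B) z<s z<s refl) ⟩
    lucas (suc A) (suc B) % p
      ≡⟨ lucas-pascal (rs (+-mono-<-≤ 0<q (m≤m*n A p))) B ⟩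
    (lucas A (suc B) + lucas (suc A) B) % p
      ≡⟨ cong₂ (λ u v → (u + v) % p) (lucas-digits-unit A (suc B) ≤-refl z<s (digitC-0ʳ ≤-refl))
                                      (lucas-digits-unit (suc A) B z<s ≤-refl (digitC-0ˡ ≤-refl)) ⟨
    (lucas (q + A * p) (suc B * p) + lucas (suc A * p) (q + B * p)) % p
      ∎
    where open ≡-Reasoning

  binomial≡lucas : ∀ a b → ((a + b) C a) % p ≡ lucas a b % p
  binomial≡lucas zero    b       = refl
  binomial≡lucas (suc a) zero    = cong (_% p) (begin
    (suc a + 0) C suc a  ≡⟨ cong (_C suc a) (+-identityʳ (suc a)) ⟩
    suc a C suc a        ≡⟨ nCn≡1 (suc a) ⟩
    1                    ≡⟨ lucasAux-0ʳ (suc a) (suc a) ⟨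
    lucas (suc a) 0      ∎)
    where open ≡-Reasoning
  binomial≡lucas (suc a) (suc b) = begin
    (suc (a + suc b) C suc a) % p
      ≡⟨ cong (_% p) (nCk+nC[k+1]≡[n+1]C[k+1] (a + suc b) a) ⟨
    ((a + suc b) C a + (a + suc b) C suc a) % p
      ≡⟨ %-distribˡ-+ ((a + suc b) C a) _ p ⟩
    (((a + suc b) C a) % p + ((a + suc b) C suc a) % p) % p
      ≡⟨ cong₂ (λ u v → (u + v) % p) (binomial≡lucas a (suc b))
               (trans (cong (λ n → (n C suc a) % p) (+-suc a b)) (binomial≡lucas (suc a) b)) ⟩
    (lucas a (suc b) % p + lucas (suc a) b % p) % p
      ≡⟨ %-distribˡ-+ (lucas a (suc b)) _ p ⟨
    (lucas a (suc b) + lucas (suc a) b) % p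
      ≡⟨ lucas-pascal (<-wellFounded a) b ⟨
    lucas (suc a) (suc b) % p
      ∎
    where open ≡-Reasoning

  carry-free-step : ∀ a b → ((a + b) C a) % p ≢ 0 →
                    a % p + b % p < p × ((a / p + b / p) C (a / p)) % p ≢ 0
  carry-free-step a b C≢0 = no-carry , C′≢0
    where
    d : ℕ
    d = digitC (a % p) (b % p)
    C′ : ℕ
    C′ = (a / p + b / p) C (a / p)

    lucas-step : ((a + b) C a) % p ≡ ((d % p) * (C′ % p)) % p
    lucas-step = begin
      ((a + b) C a) % p                              ≡⟨ binomial≡lucas a b ⟩
      lucas a b % p                                  ≡⟨ cong (_% p) (lucas-unfold a b) ⟩
      (d * lucas (a / p) (b / p)) % p                ≡⟨ %-distribˡ-* d _ p ⟩
      ((d % p) * (lucas (a / p) (b / p) % p)) % p    ≡⟨ cong (λ z → ((d % p) * z) % p) (binomial≡lucas (a / p) (b / p)) ⟨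
      ((d % p) * (C′ % p)) % p                       ∎
      where open ≡-Reasoning

    no-carry : a % p + b % p < p
    no-carry with a % p + b % p <? p
    ... | yes sum<p = sum<p
    ... | no  sum≮p = contradiction (trans lucas-step (cong (λ z → ((z % p) * (C′ % p)) % p) (C<p-≥ (a % p) (≮⇒≥ sum≮p)))) C≢0

    C′≢0 : C′ % p ≢ 0
    C′≢0 C′≡0 = C≢0 (trans lucas-step (trans (cong (λ z → ((d % p) * z) % p) C′≡0) (cong (_% p) (*-zeroʳ (d % p)))))

module Sequence (q : ℕ) where

  private
    p : ℕ
    p = suc q

  mulA-cong : ∀ {f g : Poly} → (∀ a b → f a b ≡ g a b) → ∀ a b → mulA f a b ≡ mulA g a b
  mulA-cong f≗g zero    b = refl
  mulA-cong f≗g (suc a) b = f≗g a b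

  mulB-cong : ∀ {f g : Poly} → (∀ a b → f a b ≡ g a b) → ∀ a b → mulB f a b ≡ mulB g a b
  mulB-cong f≗g a zero    = refl
  mulB-cong f≗g a (suc b) = f≗g a b

  sAux-fuel : ∀ {f g} n → n < f → n < g → ∀ a b → sAux p f n a b ≡ sAux p g n a b
  sAux-fuel {suc f} {suc g} zero    _         _         a b = refl
  sAux-fuel {suc f} {suc g} (suc n) (s≤s n<f) (s≤s n<g) a b with n <ᵇ p
  ... | true  = refl
  ... | false = cong (_% p) (cong₂ _+_
    (mulA-cong (sAux-fuel (suc n ∸ p) (≤-<-trans 1+n∸p≤n n<f) (≤-<-trans 1+n∸p≤n n<g)) a b)
    (mulB-cong (sAux-fuel (suc n ∸ p ∸ 1) (≤-<-trans 1+n∸p∸1≤n n<f) (≤-<-trans 1+n∸p∸1≤n n<g)) a b))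
    where
    1+n∸p≤n : suc n ∸ p ≤ n
    1+n∸p≤n = m∸n≤m n q
    1+n∸p∸1≤n : suc n ∸ p ∸ 1 ≤ n
    1+n∸p∸1≤n = ≤-trans (m∸n≤m (suc n ∸ p) 1) 1+n∸p≤n

  s-small : ∀ {n} a b → n < p → s p (suc n) a b ≡ 0
  s-small {n} a b n<p with n <ᵇ p | <⇒<ᵇ n<p
  ... | true | _ = refl

  s-unfold : ∀ r a b → s p (suc (p + r)) a b ≡ (mulA (s p (suc r)) a b + mulB (s p r) a b) % p
  s-unfold r a b with q + r <ᵇ q | <ᵇ⇒< (q + r) q
  ... | true  | q+r<q = contradiction (q+r<q _) (m+n≮m q r)
  ... | false | _     = cong (_% p) (cong₂ _+_ (mulA-cong step-A a b) (mulB-cong step-B a b))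
    where
    [1+p+r]∸p≡1+r : suc (p + r) ∸ p ≡ suc r
    [1+p+r]∸p≡1+r = trans (cong (_∸ p) (sym (+-suc p r))) (m+n∸m≡n p (suc r))

    step-A : ∀ a b → sAux p (suc (p + r)) (suc (p + r) ∸ p) a b ≡ s p (suc r) a b
    step-A a b = trans (cong (λ m → sAux p (suc (p + r)) m a b) [1+p+r]∸p≡1+r)
                       (sAux-fuel (suc r) (s≤s (s≤s (m≤n+m r q))) ≤-refl a b)

    step-B : ∀ a b → sAux p (suc (p + r)) (suc (p + r) ∸ p ∸ 1) a b ≡ s p r a b
    step-B a b = trans (cong (λ m → sAux p (suc (p + r)) (m ∸ 1) a b) [1+p+r]∸p≡1+r)
                       (sAux-fuel r (s≤s (m≤n+m r p)) ≤-refl a b)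

  weight : ℕ → ℕ → ℕ
  weight a b = a * p + b * suc p

  weight-sucˡ : ∀ a b → weight (suc a) b ≡ p + weight a b
  weight-sucˡ a b = +-assoc p (a * p) (b * suc p)

  weight-sucʳ : ∀ a b → weight a (suc b) ≡ suc (p + weight a b)
  weight-sucʳ = identity q
    where
    identity : ∀ q a b → a * suc q + suc (suc q + b * suc (suc q)) ≡ suc (suc q + (a * suc q + b * suc (suc q)))
    identity = solve-∀

  weight-sucˡ-inj : ∀ {r} a b → suc (p + r) ≡ weight (suc a) b → suc r ≡ weight a b
  weight-sucˡ-inj {r} a b e = +-cancelˡ-≡ p (suc r) _ (trans (+-suc p r) (trans e (weight-sucˡ a b)))

  weight-sucʳ-inj : ∀ {r} a b → suc (p + r) ≡ weight a (suc b) → r ≡ weight a b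
  weight-sucʳ-inj {r} a b e = +-cancelˡ-≡ p r _ (suc-injective (trans e (weight-sucʳ a b)))

  weight-expand : ∀ a b c → c + weight a b ≡ (b % p + c) + (a + b + b / p) * p
  weight-expand a b c = begin
    c + weight a b                                     ≡⟨ cong (λ m → c + weight a m) b≡ ⟩
    c + weight a (b % p + b / p * p)                   ≡⟨ identity q a (b % p) (b / p) c ⟩
    (b % p + c) + (a + (b % p + b / p * p) + b / p) * p ≡⟨ cong (λ m → (b % p + c) + (a + m + b / p) * p) b≡ ⟨
    (b % p + c) + (a + b + b / p) * p                  ∎
    where
    open ≡-Reasoning
    b≡ : b ≡ b % p + b / p * p
    b≡ = m≡m%n+[m/n]*n b p
    identity : ∀ q a b₀ b₁ c → c + (a * suc q + (b₀ + b₁ * suc q) * suc (suc q))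
                              ≡ (b₀ + c) + (a + (b₀ + b₁ * suc q) + b₁) * suc q
    identity = solve-∀

  weight-carry : ∀ a b → suc (a + b + b / p) ≡ suc (a % p + b % p) + weight (a / p) (b / p)
  weight-carry a b = begin
    suc (a + b + b / p)                                    ≡⟨ cong₂ (λ u v → suc (u + v + b / p)) (m≡m%n+[m/n]*n a p) (m≡m%n+[m/n]*n b p) ⟩
    suc (a % p + a / p * p + (b % p + b / p * p) + b / p)  ≡⟨ identity q (a % p) (a / p) (b % p) (b / p) ⟩
    suc (a % p + b % p) + weight (a / p) (b / p)           ∎
    where
    open ≡-Reasoning
    identity : ∀ q a₀ a₁ b₀ b₁ → suc (a₀ + a₁ * suc q + (b₀ + b₁ * suc q) + b₁)
                                ≡ suc (a₀ + b₀) + (a₁ * suc q + b₁ * suc (suc q))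
    identity = solve-∀

  weight-low-digit : ∀ a b c → b % p + c < p → (c + weight a b) % p ≡ b % p + c
  weight-low-digit a b c no-wrap =
    trans (cong (_% p) (weight-expand a b c)) ([r+kn]%n≡r (a + b + b / p) no-wrap)

  weight-wrap : ∀ a b c → c ≤ p → p ≤ b % p + c →
                (c + weight a b) % p ≤ b % p × (c + weight a b) / p ≡ suc (a % p + b % p) + weight (a / p) (b / p)
  weight-wrap a b c c≤p wrap = subst (_≤ b % p) (sym X%p≡e) e≤b₀ , X/p≡
    where
    K e : ℕ
    K = a + b + b / p
    e = b % p + c ∸ p

    e+p≡b₀+c : e + p ≡ b % p + c
    e+p≡b₀+c = m∸n+n≡m wrap

    e<p : e < p
    e<p = +-cancelʳ-< p e p (subst (_< p + p) (sym e+p≡b₀+c) (+-mono-<-≤ (m%n<n b p) c≤p))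

    e≤b₀ : e ≤ b % p
    e≤b₀ = +-cancelʳ-≤ p e (b % p) (subst (_≤ b % p + p) (sym e+p≡b₀+c) (+-monoʳ-≤ (b % p) c≤p))

    X≡e+[1+K]p : c + weight a b ≡ e + suc K * p
    X≡e+[1+K]p = begin
      c + weight a b       ≡⟨ weight-expand a b c ⟩
      (b % p + c) + K * p  ≡⟨ cong (_+ K * p) e+p≡b₀+c ⟨
      (e + p) + K * p      ≡⟨ +-assoc e p (K * p) ⟩
      e + suc K * p        ∎
      where open ≡-Reasoning

    X%p≡e : (c + weight a b) % p ≡ e
    X%p≡e = trans (cong (_% p) X≡e+[1+K]p) ([r+kn]%n≡r (suc K) e<p)

    X/p≡ : (c + weight a b) / p ≡ suc (a % p + b % p) + weight (a / p) (b / p)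
    X/p≡ = trans (cong (_/ p) X≡e+[1+K]p) (trans ([r+kn]/n≡k (suc K) e<p) (weight-carry a b))

  pathCount : ℕ → ℕ → ℕ
  pathCount a       (suc b) = (a + b) C a
  pathCount zero    zero    = 1
  pathCount (suc a) zero    = 0

  pathCount-0ˡ : ∀ b → pathCount 0 b ≡ 1
  pathCount-0ˡ zero    = refl
  pathCount-0ˡ (suc b) = refl

  pathCount-pascal : ∀ a b → pathCount a (suc b) + pathCount (suc a) b ≡ pathCount (suc a) (suc b)
  pathCount-pascal a zero    = begin
    (a + 0) C a + 0    ≡⟨ +-identityʳ _ ⟩
    (a + 0) C a        ≡⟨ cong (_C a) (+-identityʳ a) ⟩
    a C a              ≡⟨ nCn≡1 a ⟩
    1                  ≡⟨ nCn≡1 (suc a) ⟨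
    suc a C suc a      ≡⟨ cong (_C suc a) (+-identityʳ (suc a)) ⟨
    (suc a + 0) C suc a ∎
    where open ≡-Reasoning
  pathCount-pascal a (suc b) = begin
    (a + suc b) C a + suc (a + b) C suc a   ≡⟨ cong (λ n → (a + suc b) C a + n C suc a) (+-suc a b) ⟨
    (a + suc b) C a + (a + suc b) C suc a   ≡⟨ nCk+nC[k+1]≡[n+1]C[k+1] (a + suc b) a ⟩
    suc (a + suc b) C suc a                 ∎
    where open ≡-Reasoning

  data Index : ℕ → Set where
    initial : Index 0
    small   : ∀ {m} → m < p → Index (suc m)
    large   : ∀ r → Index (suc (p + r))

  index : ∀ n → Index n
  index zero    = initial
  index (suc m) with m <? p
  ... | yes m<p = small m<p
  ... | no  m≮p = subst Index (cong suc (m+[n∸m]≡n (≮⇒≥ m≮p))) (large (m ∸ p))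

  s-coeff : ∀ {n} → Acc _<_ n → ∀ a b → n ≡ weight a b → s p n a b ≡ pathCount a b % p
  s-coeff {n} rec a b n≡w with index n
  s-coeff rec zero zero _ | initial = refl
  s-coeff rec (suc a) zero n≡w | small m<p = s-small (suc a) zero m<p
  s-coeff rec a (suc b) n≡w | small {m} m<p =
    contradiction (m≤m+n p (weight a b)) (<⇒≱ (subst (_< p) (suc-injective (trans n≡w (weight-sucʳ a b))) m<p))
  s-coeff (acc rs) (suc zero) zero n≡w | large r with () ← weight-sucˡ-inj 0 0 n≡w
  s-coeff (acc rs) (suc (suc a)) zero n≡w | large r
    rewrite s-unfold r (suc (suc a)) zero
          | s-coeff (rs (s≤s (s≤s (m≤n+m r q)))) (suc a) zero (weight-sucˡ-inj (suc a) 0 n≡w)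
          = refl
  s-coeff (acc rs) zero (suc b) n≡w | large r
    rewrite s-unfold r zero (suc b)
          | s-coeff (rs (s≤s (m≤n+m r p))) zero b (weight-sucʳ-inj 0 b n≡w)
          | pathCount-0ˡ b
          = m%n%n≡m%n 1 p
  s-coeff (acc rs) (suc a) (suc b) n≡w | large r
    rewrite s-unfold r (suc a) (suc b)
          | s-coeff (rs (s≤s (s≤s (m≤n+m r q)))) a (suc b) (weight-sucˡ-inj a (suc b) n≡w)
          | s-coeff (rs (s≤s (m≤n+m r p))) (suc a) b (weight-sucʳ-inj (suc a) b n≡w)
          = trans (sym (%-distribˡ-+ (pathCount a (suc b)) _ p)) (cong (_% p) (pathCount-pascal a b))

  s-coeff-off : ∀ {n} → Acc _<_ n → ∀ a b → n ≢ weight a b → s p n a b ≡ 0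
  s-coeff-off {n} rec a b n≢w with index n
  s-coeff-off rec zero    zero    n≢w | initial = contradiction refl n≢w
  s-coeff-off rec (suc a) b       n≢w | initial = refl
  s-coeff-off rec zero    (suc b) n≢w | initial = refl
  s-coeff-off rec a       b       n≢w | small m<p = s-small a b m<p
  s-coeff-off (acc rs) a b n≢w | large r =
    trans (s-unfold r a b) (cong₂ (λ u v → (u + v) % p) (A-term a n≢w) (B-term b n≢w))
    where
    A-term : ∀ a → suc (p + r) ≢ weight a b → mulA (s p (suc r)) a b ≡ 0
    A-term zero    _   = refl
    A-term (suc a) n≢w = s-coeff-off (rs (s≤s (s≤s (m≤n+m r q)))) a b λ e →
      n≢w (trans (sym (+-suc p r)) (trans (cong (p +_) e) (sym (weight-sucˡ a b))))

    B-term : ∀ b → suc (p + r) ≢ weight a b → mulB (s p r) a b ≡ 0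
    B-term zero    _   = refl
    B-term (suc b) n≢w = s-coeff-off (rs (s≤s (m≤n+m r p))) a b λ e →
      n≢w (trans (cong (λ m → suc (p + m)) e) (sym (weight-sucʳ a b)))

module Vanishing {q : ℕ} .{{_ : NonZero q}} (p-prime : Prime (suc q)) where

  private
    p : ℕ
    p = suc q

  open DigitSum q
  open Lucas p-prime
  open Sequence q

  -- If a + b does not carry, then a digit of c + weight a b exceeds the one
  -- below it: either the lowest digit b₀ + c is at least c, or it wraps to at
  -- most b₀ and the quotient is c′ + weight (a / p) (b / p) with c′ = a₀ + b₀ + 1.
  descent : ∀ {X} → Acc _<_ X → ∀ a b c → X ≡ c + weight a b → 0 < c → c ≤ p →
            ((a + b) C a) % p ≢ 0 → X % p < c → ¬ DigitSumWitness X
  descent {X} (acc rs) a b c refl 0<c c≤p C≢0 X%p<c w with b % p + c <? p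
  ... | yes no-wrap = <⇒≱ X%p<c (subst (c ≤_) (sym (weight-low-digit a b c no-wrap)) (m≤n+m c (b % p)))
  ... | no  wrap
    with no-carry , C′≢0 ← carry-free-step a b C≢0
       | digit≤b₀ , X/p≡ ← weight-wrap a b c c≤p (≮⇒≥ wrap) =
    descent (rs X/p<X) (a / p) (b / p) (suc (a % p + b % p)) X/p≡ z<s no-carry C′≢0 digit< (witness-/ w)
    where
    digit< : (X / p) % p < suc (a % p + b % p)
    digit< = s≤s (≤-trans (witness-digit-≤ w) (≤-trans digit≤b₀ (m≤n+m (b % p) (a % p))))

    X/p<X : X / p < X
    X/p<X = m/n<m X p {{>-nonZero (<-≤-trans 0<c (m≤m+n c _))}} 1<p

  pathCount-vanishes : ∀ a b → δ p (weight a b * q) ≡ q → pathCount a b % p ≡ 0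
  pathCount-vanishes zero    zero    δ≡q = contradiction (sym δ≡q) (≢-nonZero⁻¹ q)
  pathCount-vanishes (suc a) zero    _   = refl
  pathCount-vanishes a       (suc b) δ≡q = decidable-stable (((a + b) C a) % p ≟ 0) λ C≢0 →
    descent (<-wellFounded X) a b p refl z<s ≤-refl C≢0 (m%n<n X p)
            (witness-pred X (subst (λ n → δ p (n * q) ≡ q) (weight-sucʳ a b) δ≡q))
    where
    X : ℕ
    X = p + weight a b

  s-vanishes : ∀ n → δ p (n * q) ≡ q → ∀ a b → s p n a b ≡ 0
  s-vanishes n δ≡q a b with n ≟ weight a b
  ... | no  n≢w = s-coeff-off (<-wellFounded n) a b n≢w
  ... | yes n≡w = trans (s-coeff (<-wellFounded n) a b n≡w)
                        (pathCount-vanishes a b (subst (λ m → δ p (m * q) ≡ q) n≡w δ≡q))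

proposition4p4 : (p : ℕ) .{{_ : NonZero p}} → Prime p → 5 ≤ p →
    (n : ℕ) → δ p (n * (p ∸ 1)) ≡ p ∸ 1 →
    (a b : ℕ) → s p n a b ≡ 0
proposition4p4 (suc (suc t)) p-prime _ = Vanishing.s-vanishes p-prime
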